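{- Let $d=2k+1$ with $k\ge1$, let $X\subseteq\mathbb{Z}_{2d}$ (identified with a subset of $[2d]$) with $|X|=d$, and let $\mathcal{F}(X)=\{F\in\binom{[2d]}{d}: \sum_{i\in F}i\in X \pmod{2d}\}$. Then for every $A\in\binom{[2d]}{d}$ the projection $\mathcal{F}(X)|_A$ contains all subsets of $A$ of size $1$ and of size $d-1$ if and only if for every $u\in X$, $\sum_{w\in X\setminus\{u\}}w\not\equiv 0\pmod d$.
   Context: $\mathcal{F}|_A=\{F\cap A:F\in\mathcal{F}\}$. Elements of $[2d]$ are regarded as residues modulo $2d$. -}

module Defs where

open import Data.Nat using (ℕ; suc; _+_; _*_; _∸_; _%_)
open import Data.Nat.DivMod using (_mod_)
open import Data.Nat.ListAction using (sum)
open import Data.Fin using (Fin; toℕ)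
open import Data.Fin.Subset using (Subset; _∈_; _⊆_; _∩_; ∣_∣)
open import Data.Vec using (lookup)
open import Data.List using (map; filterᵇ; allFin)
open import Data.Product using (Σ; _×_)
open import Data.Sum using (_⊎_)
open import Relation.Binary.PropositionalEquality using (_≡_; _≢_)

dOf : ℕ → ℕ
dOf k = suc (2 * k)

-- 2d, the modulus; the ground set [2d] is Fin (2d), read as residues 0,...,2d-1 mod 2d
twoD : ℕ → ℕ
twoD k = dOf k + dOf k

elemSum : ∀ {n} → Subset n → ℕ
elemSum {n} S = sum (map toℕ (filterᵇ (lookup S) (allFin n)))

inFam : (k : ℕ) → Subset (twoD k) → Subset (twoD k) → Set
inFam k X F = (∣ F ∣ ≡ dOf k) × ((elemSum F mod twoD k) ∈ X)

inProj : (k : ℕ) → Subset (twoD k) → Subset (twoD k) → Subset (twoD k) → Set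
inProj k X A B = Σ (Subset (twoD k)) (λ F → inFam k X F × (F ∩ A ≡ B))

projFull : (k : ℕ) → Subset (twoD k) → Subset (twoD k) → Set
projFull k X A = (B : Subset (twoD k)) → B ⊆ A → (∣ B ∣ ≡ 1 ⊎ ∣ B ∣ ≡ dOf k ∸ 1) → inProj k X A B

-- for every u ∈ X,  Σ_{w ∈ X∖{u}} w ≢ 0 (mod d);  since u ∈ X, Σ_{X∖{u}} w = (Σ_X w) - u
sumCond : (k : ℕ) → Subset (twoD k) → Set
sumCond k X = (u : Fin (twoD k)) → u ∈ X → ((elemSum X ∸ toℕ u) % dOf k) ≢ 0

-- For |A| = d and a ∈ A, a set F of size d with F ∩ A = {a} has the form {a} ∪ (∁A ∖ {b})
-- with b ∉ A and element sum c − b, where c = Σ ∁A + a; one with F ∩ A = A ∖ {a} has the form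
-- (A ∖ {a}) ∪ {b} with element sum e + b, where e = Σ A − a.  If the projection misses {a}
-- (resp. A ∖ {a}), the bijection b ↦ c − b (resp. b ↦ e + b) of ℤ/2d maps ∁A into ∁X; as both
-- have d elements, it maps A onto X.  Summing over A then shows that u = c − a (resp. e + a)
-- lies in X with Σ (X ∖ {u}) ≡ 0 (mod d), using d ∣ 0 + 1 + ⋯ + (2d − 1).  Conversely, if
-- u ∈ X and Σ (X ∖ {u}) = t d, then A = X − t and a = u − t have e ≡ t, so every candidate
-- sum e + b with b ∉ A lies outside X.

module Submission where

open import Data.Bool using (Bool; true; false; not; _∧_; _∨_; if_then_else_)
open import Data.Bool.Properties using (∧-identityʳ; ∧-zeroʳ; ∧-conicalˡ; ∧-conicalʳ; ¬-not; not-injective)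
import Data.Bool.Properties as Bool
open import Data.Fin using (Fin; toℕ; punchIn)
import Data.Fin as Fin
open import Data.Fin.Permutation using (Permutation′; permutation; _⟨$⟩ʳ_)
open import Data.Fin.Properties using (toℕ-injective; toℕ<n; toℕ-fromℕ<; _≟_; any?; punchInᵢ≢i)
open import Data.Fin.Subset using (Subset; ∣_∣)
import Data.Fin.Subset as Sub
import Data.List as List
open import Data.Nat using (ℕ; zero; suc; _+_; _*_; _∸_; _%_; _≤_; NonZero)
open import Data.Nat.DivMod
open import Data.Nat.Divisibility using (_∣_; divides; ∣-refl; m%n≡0⇒n∣m; n∣m⇒m%n≡0; n∣m*n; ∣m+n∣m⇒∣n)
open import Data.Nat.ListAction using () renaming (sum to listSum)
open import Data.Nat.Properties hiding (_≟_)
open import Data.Nat.Tactic.RingSolver using (solve-∀)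
open import Data.Product using (∃; _×_; _,_)
open import Data.Sum using (_⊎_; inj₁; inj₂)
open import Data.Vec using ([]; _∷_; lookup; tabulate)
open import Data.Vec.Properties
  using ([]=⇒lookup; lookup⇒[]=; lookup-zipWith; lookup∘tabulate; tabulate∘lookup; tabulate-cong)
open import Function using (_∘_)
open import Relation.Binary.Bundles using (Setoid)
open import Relation.Binary.PropositionalEquality
import Relation.Binary.Reasoning.Setoid as SetoidReasoning
open import Relation.Nullary using (does; yes; no; ¬_; _×-dec_; contradiction)

open import Algebra.Properties.CommutativeSemigroup +-commutativeSemigroup using (xy∙z≈xz∙y; xy∙z≈zy∙x)
open import Algebra.Properties.Semiring.Sum +-*-semiring
  using (sum; sum-cong-≗; ∑-distrib-+; sum-permute; *-distribˡ-sum; sum-remove; sum-replicate-zero)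

open import Defs

sum-single : ∀ {n} (x : Fin n) (t : Fin n → ℕ) → (∀ i → i ≢ x → t i ≡ 0) → sum t ≡ t x
sum-single {suc n} x t t≡0 = begin
  sum t                                ≡⟨ sum-remove t ⟩
  t x + sum (λ j → t (punchIn x j))    ≡⟨ cong (t x +_) (sum-cong-≗ {n} (λ j → t≡0 _ (punchInᵢ≢i x j))) ⟩
  t x + sum {n} (λ _ → 0)              ≡⟨ cong (t x +_) (sum-replicate-zero n) ⟩
  t x + 0                              ≡⟨ +-identityʳ (t x) ⟩
  t x                                  ∎
  where open ≡-Reasoning

sum-ones : ∀ n → sum {n} (λ _ → 1) ≡ n
sum-ones zero    = refl
sum-ones (suc n) = cong suc (sum-ones n)

sum-toℕ : ∀ n → sum {n} toℕ * 2 + n ≡ n * n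
sum-toℕ zero    = refl
sum-toℕ (suc n) = begin
  sum {n} (λ i → suc (toℕ i)) * 2 + suc n ≡⟨ cong (λ s → s * 2 + suc n) shifted ⟩
  (n + sum {n} toℕ) * 2 + suc n           ≡⟨ regroup n (sum {n} toℕ) ⟩
  (sum {n} toℕ * 2 + n) + suc (n + n)     ≡⟨ cong (_+ suc (n + n)) (sum-toℕ n) ⟩
  n * n + suc (n + n)                     ≡⟨ square n ⟩
  suc n * suc n                           ∎
  where
  open ≡-Reasoning
  shifted : sum {n} (λ i → suc (toℕ i)) ≡ n + sum {n} toℕ
  shifted = trans (∑-distrib-+ {n} (λ _ → 1) toℕ) (cong (_+ sum {n} toℕ) (sum-ones n))
  regroup : ∀ n s → (n + s) * 2 + suc n ≡ (s * 2 + n) + suc (n + n)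
  regroup = solve-∀
  square : ∀ n → n * n + suc (n + n) ≡ suc n * suc n
  square = solve-∀

module _ {n : ℕ} where

  infix  4 _⊆_
  infixl 6 _-_
  infixl 7 _∩_

  ∁ : (Fin n → Bool) → (Fin n → Bool)
  ∁ p i = not (p i)

  _∩_ : (Fin n → Bool) → (Fin n → Bool) → (Fin n → Bool)
  (p ∩ q) i = p i ∧ q i

  ⁅_⁆ : Fin n → (Fin n → Bool)
  ⁅ x ⁆ i = does (i ≟ x)

  _-_ : (Fin n → Bool) → Fin n → (Fin n → Bool)
  (p - x) i = p i ∧ not (⁅ x ⁆ i)

  insert : Fin n → (Fin n → Bool) → (Fin n → Bool)
  insert x p i = ⁅ x ⁆ i ∨ p i

  sumOver : (Fin n → Bool) → (Fin n → ℕ) → ℕ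
  sumOver p w = sum (λ i → if p i then w i else 0)

  size : (Fin n → Bool) → ℕ
  size p = sumOver p (λ _ → 1)

  elemTotal : (Fin n → Bool) → ℕ
  elemTotal p = sumOver p toℕ

  _⊆_ : (Fin n → Bool) → (Fin n → Bool) → Set
  p ⊆ q = ∀ i → p i ≡ true → q i ≡ true

  sumOver-cong : ∀ {p q} w → p ≗ q → sumOver p w ≡ sumOver q w
  sumOver-cong w p≗q = sum-cong-≗ (λ i → cong (λ b → if b then w i else 0) (p≗q i))

  sumOver-split : ∀ p q w → sumOver p w ≡ sumOver (p ∩ q) w + sumOver (p ∩ ∁ q) w
  sumOver-split p q w = trans (sum-cong-≗ pointwise) (∑-distrib-+ {n} _ _)
    where
    pointwise : ∀ i → (if p i then w i else 0)
                    ≡ (if p i ∧ q i then w i else 0) + (if p i ∧ not (q i) then w i else 0)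
    pointwise i with p i | q i
    ... | true  | true  = sym (+-identityʳ (w i))
    ... | true  | false = refl
    ... | false | _     = refl

  sumOver-+ : ∀ p v w → sumOver p (λ i → v i + w i) ≡ sumOver p v + sumOver p w
  sumOver-+ p v w = trans (sum-cong-≗ pointwise) (∑-distrib-+ {n} _ _)
    where
    pointwise : ∀ i → (if p i then v i + w i else 0) ≡ (if p i then v i else 0) + (if p i then w i else 0)
    pointwise i with p i
    ... | true  = refl
    ... | false = refl

  sumOver-const : ∀ p c → sumOver p (λ _ → c) ≡ c * size p
  sumOver-const p c = trans (sum-cong-≗ pointwise) (sym (*-distribˡ-sum {n} c _))
    where
    pointwise : ∀ i → (if p i then c else 0) ≡ c * (if p i then 1 else 0)
    pointwise i with p i
    ... | true  = sym (*-identityʳ c)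
    ... | false = sym (*-zeroʳ c)

  x∈⁅x⁆ : ∀ x → ⁅ x ⁆ x ≡ true
  x∈⁅x⁆ x with x ≟ x
  ... | yes _   = refl
  ... | no x≢x  = contradiction refl x≢x

  x≢y⇒x∉⁅y⁆ : ∀ {x y} → x ≢ y → ⁅ y ⁆ x ≡ false
  x≢y⇒x∉⁅y⁆ {x} {y} x≢y with x ≟ y
  ... | yes x≡y = contradiction x≡y x≢y
  ... | no _    = refl

  sumOver-singleton : ∀ x w → sumOver ⁅ x ⁆ w ≡ w x
  sumOver-singleton x w = trans (sum-single x _ outside) (cong (λ b → if b then w x else 0) (x∈⁅x⁆ x))
    where
    outside : ∀ i → i ≢ x → (if ⁅ x ⁆ i then w i else 0) ≡ 0
    outside i i≢x = cong (λ b → if b then w i else 0) (x≢y⇒x∉⁅y⁆ i≢x)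

  sumOver-remove : ∀ {p x} w → p x ≡ true → sumOver p w ≡ w x + sumOver (p - x) w
  sumOver-remove {p} {x} w px = begin
    sumOver p w                               ≡⟨ sumOver-split p ⁅ x ⁆ w ⟩
    sumOver (p ∩ ⁅ x ⁆) w + sumOver (p - x) w ≡⟨ cong (_+ sumOver (p - x) w) (sumOver-cong w p∩x≗x) ⟩
    sumOver ⁅ x ⁆ w + sumOver (p - x) w       ≡⟨ cong (_+ sumOver (p - x) w) (sumOver-singleton x w) ⟩
    w x + sumOver (p - x) w                   ∎
    where
    open ≡-Reasoning
    p∩x≗x : p ∩ ⁅ x ⁆ ≗ ⁅ x ⁆
    p∩x≗x i with i ≟ x
    ... | yes refl = trans (∧-identityʳ (p i)) px
    ... | no _     = ∧-zeroʳ (p i)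

  insert-∈ : ∀ x p → insert x p x ≡ true
  insert-∈ x p = cong (_∨ p x) (x∈⁅x⁆ x)

  insert-remove : ∀ {p x} → p x ≡ false → insert x p - x ≗ p
  insert-remove {p} {x} px i with i ≟ x
  ... | yes refl = sym px
  ... | no _     = ∧-identityʳ (p i)

  sumOver-insert : ∀ {p x} w → p x ≡ false → sumOver (insert x p) w ≡ w x + sumOver p w
  sumOver-insert {p} {x} w px =
    trans (sumOver-remove w (insert-∈ x p)) (cong (w x +_) (sumOver-cong w (insert-remove px)))

  sumOver-∁ : ∀ p w → sumOver p w + sumOver (∁ p) w ≡ sum w
  sumOver-∁ p w = sym (sumOver-split (λ _ → true) p w)

  size-∁ : ∀ p → size p + size (∁ p) ≡ n
  size-∁ p = trans (sumOver-∁ p (λ _ → 1)) (sum-ones n)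

  size≡0⇒empty : ∀ {p} → size p ≡ 0 → ∀ i → p i ≡ false
  size≡0⇒empty {p} size≡0 i with p i in pi
  ... | false = refl
  ... | true  = contradiction (trans (sym (sumOver-remove (λ _ → 1) pi)) size≡0) λ ()

  empty⇒size≡0 : ∀ {p} → (∀ i → p i ≡ false) → size p ≡ 0
  empty⇒size≡0 p≡false = trans (sumOver-cong (λ _ → 1) p≡false) (sum-replicate-zero n)

  size≡1⇒singleton : ∀ {p} → size p ≡ 1 → ∃ λ x → p ≗ ⁅ x ⁆
  size≡1⇒singleton {p} size≡1 with any? (λ i → p i Bool.≟ true)
  ... | yes (x , px) = x , pointwise
    where
    rest-empty : ∀ i → (p - x) i ≡ false
    rest-empty = size≡0⇒empty (suc-injective (trans (sym (sumOver-remove (λ _ → 1) px)) size≡1))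
    pointwise : p ≗ ⁅ x ⁆
    pointwise i with i ≟ x | rest-empty i
    ... | yes refl | _         = px
    ... | no _     | rest-at-i = trans (sym (∧-identityʳ (p i))) rest-at-i
  ... | no ¬any = contradiction (trans (sym size≡1) (empty⇒size≡0 (λ i → ¬-not (λ pi → ¬any (i , pi))))) λ ()

  ⊆⇒∩≗ : ∀ {p q} → q ⊆ p → p ∩ q ≗ q
  ⊆⇒∩≗ {p} {q} q⊆p i with q i in qi
  ... | true  = trans (∧-identityʳ (p i)) (q⊆p i qi)
  ... | false = ∧-zeroʳ (p i)

  ⊆∧size≡⇒≗ : ∀ {p q} → p ⊆ q → size q ≡ size p → p ≗ q
  ⊆∧size≡⇒≗ {p} {q} p⊆q size≡ = pointwise
    where
    q∖p-empty : ∀ i → q i ∧ not (p i) ≡ false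
    q∖p-empty = size≡0⇒empty (+-cancelˡ-≡ (size p) _ 0 (begin
      size p + size (q ∩ ∁ p)        ≡⟨ cong (_+ size (q ∩ ∁ p)) (sumOver-cong (λ _ → 1) (⊆⇒∩≗ p⊆q)) ⟨
      size (q ∩ p) + size (q ∩ ∁ p)  ≡⟨ sumOver-split q p _ ⟨
      size q                         ≡⟨ size≡ ⟩
      size p                         ≡⟨ +-identityʳ (size p) ⟨
      size p + 0                     ∎))
      where open ≡-Reasoning
    pointwise : p ≗ q
    pointwise i with p i in pi
    ... | true  = sym (p⊆q i pi)
    ... | false = sym (trans (sym (∧-identityʳ (q i)))
                             (subst (λ b → q i ∧ not b ≡ false) pi (q∖p-empty i)))

  sumOver-image : ∀ (π : Permutation′ n) {p q} w →
                  p ∘ (π ⟨$⟩ʳ_) ≗ q → sumOver p w ≡ sumOver q (w ∘ (π ⟨$⟩ʳ_))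
  sumOver-image π {p} {q} w p∘π≗q = trans (sum-permute _ π) (sumOver-cong (w ∘ (π ⟨$⟩ʳ_)) p∘π≗q)

  size-∘permutation : ∀ (π : Permutation′ n) p → size (p ∘ (π ⟨$⟩ʳ_)) ≡ size p
  size-∘permutation π p = sym (sumOver-image π (λ _ → 1) (λ _ → refl))

  sumOver-exchange : ∀ {p x y} w → p x ≡ false → p y ≡ true →
                     sumOver (insert x (p - y)) w + w y ≡ sumOver p w + w x
  sumOver-exchange {p} {x} {y} w px py = begin
    sumOver (insert x (p - y)) w + w y ≡⟨ cong (_+ w y) (sumOver-insert w p-y∌x) ⟩
    w x + sumOver (p - y) w + w y      ≡⟨ xy∙z≈zy∙x (w x) (sumOver (p - y) w) (w y) ⟩
    w y + sumOver (p - y) w + w x      ≡⟨ cong (_+ w x) (sumOver-remove w py) ⟨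
    sumOver p w + w x                  ∎
    where
    open ≡-Reasoning
    p-y∌x : (p - y) x ≡ false
    p-y∌x = cong (_∧ not (⁅ y ⁆ x)) px

  size-exchange : ∀ {p x y} → p x ≡ false → p y ≡ true → size (insert x (p - y)) ≡ size p
  size-exchange px py = +-cancelʳ-≡ 1 _ _ (sumOver-exchange (λ _ → 1) px py)

  toℕ≤elemTotal : ∀ {p x} → p x ≡ true → toℕ x ≤ elemTotal p
  toℕ≤elemTotal {p} {x} px = subst (toℕ x ≤_) (sym (sumOver-remove toℕ px)) (m≤m+n (toℕ x) _)

  hit-or-image : ∀ {p q} (π : Permutation′ n) → size p ≡ size q →
                 (∃ λ b → q b ≡ false × p (π ⟨$⟩ʳ b) ≡ true) ⊎ (p ∘ (π ⟨$⟩ʳ_) ≗ q)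
  hit-or-image {p} {q} π size≡
    with any? (λ b → (q b Bool.≟ false) ×-dec (p (π ⟨$⟩ʳ b) Bool.≟ true))
  ... | yes hit  = inj₁ hit
  ... | no ¬hit = inj₂ (λ i → not-injective (sym (∁q≗∁pπ i)))
    where
    pπ = p ∘ (π ⟨$⟩ʳ_)
    ∁q⊆∁pπ : ∁ q ⊆ ∁ pπ
    ∁q⊆∁pπ b ∁qb = cong not (¬-not (λ pπb → ¬hit (b , not-injective ∁qb , pπb)))
    size-pπ : size pπ ≡ size q
    size-pπ = trans (size-∘permutation π p) size≡
    ∁q≗∁pπ : ∁ q ≗ ∁ pπ
    ∁q≗∁pπ = ⊆∧size≡⇒≗ ∁q⊆∁pπ (+-cancelˡ-≡ (size q) _ _ (begin
      size q + size (∁ pπ)   ≡⟨ cong (_+ size (∁ pπ)) size-pπ ⟨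
      size pπ + size (∁ pπ)  ≡⟨ size-∁ pπ ⟩
      n                      ≡⟨ size-∁ q ⟨
      size q + size (∁ q)    ∎))
      where open ≡-Reasoning

  split-off-one : ∀ {p q} → size p ≡ suc (size (p ∩ q)) → ∃ λ x → p ∩ ∁ q ≗ ⁅ x ⁆
  split-off-one {p} {q} size≡ = size≡1⇒singleton (+-cancelˡ-≡ (size (p ∩ q)) _ 1 (begin
    size (p ∩ q) + size (p ∩ ∁ q) ≡⟨ sumOver-split p q _ ⟨
    size p                        ≡⟨ size≡ ⟩
    suc (size (p ∩ q))            ≡⟨ +-comm 1 (size (p ∩ q)) ⟩
    size (p ∩ q) + 1              ∎))
    where open ≡-Reasoning

  insert-split : ∀ {p q x} → p ∩ ∁ q ≗ ⁅ x ⁆ → p ≗ insert x (p ∩ q)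
  insert-split {p} {q} {x} p∖q≗x i with i ≟ x | p i | q i | p∖q≗x i
  ... | yes refl | true  | _     | _  = refl
  ... | yes refl | false | _     | ()
  ... | no _     | true  | true  | _  = refl
  ... | no _     | true  | false | ()
  ... | no _     | false | _     | _  = refl

  remove-split : ∀ {p q x} → q ⊆ p → p ∩ ∁ q ≗ ⁅ x ⁆ → q ≗ p - x
  remove-split {p} {q} {x} q⊆p p∖q≗x i with i ≟ x | q i in qi | p i in pi | p∖q≗x i
  ... | yes refl | false | true  | _  = refl
  ... | yes refl | false | false | ()
  ... | yes refl | true  | true  | ()
  ... | yes refl | true  | false | ()
  ... | no _     | true  | true  | _  = refl
  ... | no _     | true  | false | _  = contradiction (trans (sym (q⊆p i qi)) pi) λ ()
  ... | no _     | false | false | _  = refl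
  ... | no _     | false | true  | ()

  size≡1∧⊆⇒singleton : ∀ {p q} → q ⊆ p → size q ≡ 1 → ∃ λ x → p x ≡ true × q ≗ ⁅ x ⁆
  size≡1∧⊆⇒singleton {p} {q} q⊆p size≡1 with size≡1⇒singleton size≡1
  ... | x , q≗x = x , q⊆p x (trans (q≗x x) (x∈⁅x⁆ x)) , q≗x

  size≡suc∧⊆⇒remove : ∀ {p q} → q ⊆ p → size p ≡ suc (size q) → ∃ λ x → p x ≡ true × q ≗ p - x
  size≡suc∧⊆⇒remove {p} {q} q⊆p size≡
    with split-off-one {p} {q} (trans size≡ (cong suc (sumOver-cong (λ _ → 1) (sym ∘ ⊆⇒∩≗ q⊆p))))
  ... | x , p∖q≗x = x , ∧-conicalˡ (p x) _ (trans (p∖q≗x x) (x∈⁅x⁆ x)) , remove-split q⊆p p∖q≗x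

module Congruence (m : ℕ) .{{_ : NonZero m}} where

  infix 4 _≈_
  record _≈_ (a b : ℕ) : Set where
    constructor mk≈
    field residue : a % m ≡ b % m

  ≈-reflexive : ∀ {a b} → a ≡ b → a ≈ b
  ≈-reflexive a≡b = mk≈ (cong (_% m) a≡b)

  ≈-refl : ∀ {a} → a ≈ a
  ≈-refl = mk≈ refl

  ≈-sym : ∀ {a b} → a ≈ b → b ≈ a
  ≈-sym (mk≈ p) = mk≈ (sym p)

  ≈-trans : ∀ {a b c} → a ≈ b → b ≈ c → a ≈ c
  ≈-trans (mk≈ p) (mk≈ q) = mk≈ (trans p q)

  ≈-setoid : Setoid _ _
  ≈-setoid = record
    { Carrier = ℕ ; _≈_ = _≈_
    ; isEquivalence = record { refl = ≈-refl ; sym = ≈-sym ; trans = ≈-trans } }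

  module ≈-Reasoning = SetoidReasoning ≈-setoid

  %-≈ : ∀ a → a % m ≈ a
  %-≈ a = mk≈ (m%n%n≡m%n a m)

  m≈0 : m ≈ 0
  m≈0 = mk≈ (trans (n%n≡0 m) (sym (m*n%n≡0 0 m)))

  +-cong : ∀ {a b c e} → a ≈ b → c ≈ e → a + c ≈ b + e
  +-cong {a} {b} {c} {e} (mk≈ p) (mk≈ q) = mk≈ (begin
    (a + c) % m           ≡⟨ %-distribˡ-+ a c m ⟩
    (a % m + c % m) % m   ≡⟨ cong₂ (λ x y → (x + y) % m) p q ⟩
    (b % m + e % m) % m   ≡⟨ %-distribˡ-+ b e m ⟨
    (b + e) % m           ∎)
    where open ≡-Reasoning

  +-congˡ : ∀ a {b c} → b ≈ c → a + b ≈ a + c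
  +-congˡ a = +-cong (≈-refl {a})

  +-congʳ : ∀ c {a b} → a ≈ b → a + c ≈ b + c
  +-congʳ c a≈b = +-cong a≈b (≈-refl {c})

  negate : ℕ → ℕ
  negate a = m ∸ a % m

  +-inverseʳ : ∀ a → a + negate a ≈ 0
  +-inverseʳ a = begin
    a + (m ∸ a % m)     ≈⟨ +-congʳ (m ∸ a % m) (≈-sym (%-≈ a)) ⟩
    a % m + (m ∸ a % m) ≡⟨ m+[n∸m]≡n (m%n≤n a m) ⟩
    m                   ≈⟨ m≈0 ⟩
    0                   ∎
    where open ≈-Reasoning

  +-inverseˡ : ∀ a → negate a + a ≈ 0
  +-inverseˡ a = ≈-trans (≈-reflexive (+-comm (negate a) a)) (+-inverseʳ a)

  negate-cong : ∀ {a b} → a ≈ b → negate a ≡ negate b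
  negate-cong (mk≈ p) = cong (m ∸_) p

  +-negate-cancel : ∀ a b → a + b + negate b ≈ a
  +-negate-cancel a b = begin
    a + b + negate b     ≡⟨ +-assoc a b (negate b) ⟩
    a + (b + negate b)   ≈⟨ +-congˡ a (+-inverseʳ b) ⟩
    a + 0                ≡⟨ +-identityʳ a ⟩
    a                    ∎
    where open ≈-Reasoning

  +-cancelʳ : ∀ {a b} z → a + z ≈ b + z → a ≈ b
  +-cancelʳ {a} {b} z a+z≈b+z = begin
    a                 ≈⟨ +-negate-cancel a z ⟨
    a + z + negate z  ≈⟨ +-congʳ (negate z) a+z≈b+z ⟩
    b + z + negate z  ≈⟨ +-negate-cancel b z ⟩
    b                 ∎
    where open ≈-Reasoning

  +-cancelˡ : ∀ {a b} z → z + a ≈ z + b → a ≈ b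
  +-cancelˡ {a} {b} z z+a≈z+b =
    +-cancelʳ z (≈-trans (≈-reflexive (+-comm a z)) (≈-trans z+a≈z+b (≈-reflexive (+-comm z b))))

  negate-+-cancel : ∀ a b → a + negate b + b ≈ a
  negate-+-cancel a b = ≈-trans (≈-reflexive (xy∙z≈xz∙y a (negate b) b)) (+-negate-cancel a b)

  +≈⇒≈+negate : ∀ {a b c} → a + b ≈ c → a ≈ c + negate b
  +≈⇒≈+negate {a} {b} {c} a+b≈c = +-cancelʳ b (≈-trans a+b≈c (≈-sym (negate-+-cancel c b)))

  sum-cong-≈ : ∀ {k} {v w : Fin k → ℕ} → (∀ i → v i ≈ w i) → sum v ≈ sum w
  sum-cong-≈ {zero}  v≈w = ≈-refl
  sum-cong-≈ {suc k} v≈w = +-cong (v≈w Fin.zero) (sum-cong-≈ (v≈w ∘ Fin.suc))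

  sumOver-cong-≈ : ∀ {k} (p : Fin k → Bool) {v w} → (∀ i → v i ≈ w i) → sumOver p v ≈ sumOver p w
  sumOver-cong-≈ p v≈w = sum-cong-≈ pointwise
    where
    pointwise : ∀ i → (if p i then _ else 0) ≈ (if p i then _ else 0)
    pointwise i with p i
    ... | true  = v≈w i
    ... | false = ≈-refl

  ∣-respects-≈ : ∀ {d a b} .{{_ : NonZero d}} → d ∣ m → a ≈ b → d ∣ a → d ∣ b
  ∣-respects-≈ {d} {a} {b} d∣m (mk≈ p) d∣a = m%n≡0⇒n∣m b d (begin
    b % d       ≡⟨ m∣n⇒o%n%m≡o%m d m b d∣m ⟨
    b % m % d   ≡⟨ cong (_% d) p ⟨
    a % m % d   ≡⟨ m∣n⇒o%n%m≡o%m d m a d∣m ⟩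
    a % d       ≡⟨ n∣m⇒m%n≡0 a d d∣a ⟩
    0           ∎)
    where open ≡-Reasoning

  toℕ-mod : ∀ a → toℕ (a mod m) ≈ a
  toℕ-mod a = ≈-trans (≈-reflexive (toℕ-fromℕ< (m%n<n a m))) (%-≈ a)

  mod-cong : ∀ {a b} → a ≈ b → a mod m ≡ b mod m
  mod-cong {a} {b} (mk≈ p) = toℕ-injective (begin
    toℕ (a mod m) ≡⟨ toℕ-fromℕ< (m%n<n a m) ⟩
    a % m         ≡⟨ p ⟩
    b % m         ≡⟨ toℕ-fromℕ< (m%n<n b m) ⟨
    toℕ (b mod m) ∎)
    where open ≡-Reasoning

  toℕ-≈-injective : ∀ {x y : Fin m} → toℕ x ≈ toℕ y → x ≡ y
  toℕ-≈-injective {x} {y} (mk≈ p) = toℕ-injective (begin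
    toℕ x      ≡⟨ m<n⇒m%n≡m (toℕ<n x) ⟨
    toℕ x % m  ≡⟨ p ⟩
    toℕ y % m  ≡⟨ m<n⇒m%n≡m (toℕ<n y) ⟩
    toℕ y      ∎)
    where open ≡-Reasoning

module AffineMaps (m : ℕ) .{{_ : NonZero m}} where

  open Congruence m

  shift : ℕ → Fin m → Fin m
  shift e x = (e + toℕ x) mod m

  reflect : ℕ → Fin m → Fin m
  reflect c x = (c + negate (toℕ x)) mod m

  shift-cong : ∀ {e e'} → e ≈ e' → ∀ x → shift e x ≡ shift e' x
  shift-cong e≈e' x = mod-cong (+-congʳ (toℕ x) e≈e')

  shift-cancel : ∀ {a b} → a + b ≈ 0 → ∀ x → shift a (shift b x) ≡ x
  shift-cancel {a} {b} a+b≈0 x = toℕ-≈-injective (begin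
    toℕ (shift a (shift b x)) ≈⟨ toℕ-mod _ ⟩
    a + toℕ (shift b x)       ≈⟨ +-congˡ a (toℕ-mod (b + toℕ x)) ⟩
    a + (b + toℕ x)           ≡⟨ +-assoc a b (toℕ x) ⟨
    a + b + toℕ x             ≈⟨ +-congʳ (toℕ x) a+b≈0 ⟩
    toℕ x                     ∎)
    where open ≈-Reasoning

  reflect-involutive : ∀ c x → reflect c (reflect c x) ≡ x
  reflect-involutive c x = toℕ-≈-injective (+-cancelʳ (negate (toℕ x)) (begin
    toℕ (reflect c y) + negate (toℕ x)   ≈⟨ +-congʳ (negate (toℕ x)) (toℕ-mod (c + negate (toℕ y))) ⟩
    c + negate (toℕ y) + negate (toℕ x)  ≡⟨ cong (λ t → c + t + negate (toℕ x)) (negate-cong (toℕ-mod s)) ⟩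
    c + negate s + negate (toℕ x)        ≡⟨ xy∙z≈xz∙y c (negate s) (negate (toℕ x)) ⟩
    s + negate s                         ≈⟨ +-inverseʳ s ⟩
    0                                    ≈⟨ +-inverseʳ (toℕ x) ⟨
    toℕ x + negate (toℕ x)               ∎))
    where
    open ≈-Reasoning
    y = reflect c x
    s = c + negate (toℕ x)

  shiftPerm : ℕ → Permutation′ m
  shiftPerm e = permutation (shift e) (shift (negate e))
    (shift-cancel (+-inverseʳ e)) (shift-cancel (+-inverseˡ e))

  reflectPerm : ℕ → Permutation′ m
  reflectPerm c = permutation (reflect c) (reflect c) (reflect-involutive c) (reflect-involutive c)

-- d = suc d′ makes NonZero (d + d) available to instance search.
module Core (d′ : ℕ) where

  private
    d = suc d′
    n = d + d

  open Congruence n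
  open AffineMaps n

  InProjection : (X A B : Fin n → Bool) → Set
  InProjection X A B = ∃ λ F → size F ≡ d × X (elemTotal F mod n) ≡ true × F ∩ A ≗ B

  Violation : (Fin n → Bool) → Fin n → Set
  Violation X u = X u ≡ true × d ∣ (elemTotal X ∸ toℕ u)

  InProjection-cong : ∀ {X A A' B B'} → A ≗ A' → B ≗ B' → InProjection X A B → InProjection X A' B'
  InProjection-cong A≗A' B≗B' (F , size≡d , total∈X , F∩A≗B) =
    F , size≡d , total∈X , λ i → trans (cong (F i ∧_) (sym (A≗A' i))) (trans (F∩A≗B i) (B≗B' i))

  d∣n : d ∣ n
  d∣n = divides 2 (cong (d +_) (sym (+-identityʳ d)))

  d∣sum-toℕ : d ∣ sum {n} toℕ
  d∣sum-toℕ = ∣m+n∣m⇒∣n (divides (d + d) d+S≡[d+d]*d) ∣-refl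
    where
    S = sum {n} toℕ
    regroup : ∀ d S → (d + S) * 2 ≡ S * 2 + (d + d)
    regroup = solve-∀
    square : ∀ d → (d + d) * (d + d) ≡ (d + d) * d * 2
    square = solve-∀
    d+S≡[d+d]*d : d + S ≡ (d + d) * d
    d+S≡[d+d]*d = *-cancelʳ-≡ _ _ 2 (begin
      (d + S) * 2      ≡⟨ regroup d S ⟩
      S * 2 + n        ≡⟨ sum-toℕ n ⟩
      n * n            ≡⟨ square d ⟩
      (d + d) * d * 2  ∎)
      where open ≡-Reasoning

  size-∁≡d : ∀ {A} → size A ≡ d → size (∁ A) ≡ d
  size-∁≡d {A} size≡d = +-cancelˡ-≡ d _ _ (trans (cong (_+ size (∁ A)) (sym size≡d)) (size-∁ A))

  -- For b ∉ A, the set {a} ∪ (∁ A ∖ {b}) has element sum reflectionCentre A a − b.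
  reflectionCentre : (Fin n → Bool) → Fin n → ℕ
  reflectionCentre A a = elemTotal (∁ A) + toℕ a

  -- For b ∉ A, the set (A ∖ {a}) ∪ {b} has element sum translationOffset A a + b.
  translationOffset : (Fin n → Bool) → Fin n → ℕ
  translationOffset A a = elemTotal A + negate (toℕ a)

  singleton-total : ∀ {A a b} → A a ≡ true → A b ≡ false →
                    elemTotal (insert a (∁ A - b)) mod n ≡ reflect (reflectionCentre A a) b
  singleton-total {A} {a} {b} Aa Ab = mod-cong total≈
    where
    total≈ : elemTotal (insert a (∁ A - b)) ≈ reflectionCentre A a + negate (toℕ b)
    total≈ = +≈⇒≈+negate (≈-reflexive (sumOver-exchange {p = ∁ A} toℕ (cong not Aa) (cong not Ab)))

  coSingleton-total : ∀ {A a b} → A a ≡ true → A b ≡ false →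
                      elemTotal (insert b (A - a)) mod n ≡ shift (translationOffset A a) b
  coSingleton-total {A} {a} {b} Aa Ab = mod-cong total≈
    where
    total≈ : elemTotal (insert b (A - a)) ≈ translationOffset A a + toℕ b
    total≈ = ≈-trans (+≈⇒≈+negate (≈-reflexive (sumOver-exchange {p = A} toℕ Ab Aa)))
                     (≈-reflexive (xy∙z≈xz∙y (elemTotal A) (toℕ b) (negate (toℕ a))))

  singleton-∈projection⁺ : ∀ {X A a b} → size A ≡ d → A a ≡ true → A b ≡ false →
                          X (reflect (reflectionCentre A a) b) ≡ true → InProjection X A ⁅ a ⁆
  singleton-∈projection⁺ {X} {A} {a} {b} size≡d Aa Ab hit =
    insert a (∁ A - b) ,
    trans (size-exchange {p = ∁ A} (cong not Aa) (cong not Ab)) (size-∁≡d {A} size≡d) ,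
    trans (cong X (singleton-total {A} Aa Ab)) hit ,
    trace
    where
    trace : insert a (∁ A - b) ∩ A ≗ ⁅ a ⁆
    trace i with i ≟ a | A i in Ai
    ... | yes refl | _     = trans (sym Ai) Aa
    ... | no _     | true  = refl
    ... | no _     | false = ∧-zeroʳ _

  coSingleton-∈projection⁺ : ∀ {X A a b} → size A ≡ d → A a ≡ true → A b ≡ false →
                            X (shift (translationOffset A a) b) ≡ true → InProjection X A (A - a)
  coSingleton-∈projection⁺ {X} {A} {a} {b} size≡d Aa Ab hit =
    insert b (A - a) ,
    trans (size-exchange {p = A} Ab Aa) size≡d ,
    trans (cong X (coSingleton-total {A} Aa Ab)) hit ,
    trace
    where
    trace : insert b (A - a) ∩ A ≗ A - a
    trace i with i ≟ b | A i in Ai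
    ... | yes refl | true  = contradiction (trans (sym Ai) Ab) λ ()
    ... | yes refl | false = refl
    ... | no _     | true  = ∧-identityʳ _
    ... | no _     | false = refl

  coSingleton-∈projection⁻ : ∀ {X A a} → size A ≡ d → A a ≡ true → InProjection X A (A - a) →
                               ∃ λ b → A b ≡ false × X (shift (translationOffset A a) b) ≡ true
  coSingleton-∈projection⁻ {X} {A} {a} size≡d Aa (F , sizeF≡d , total∈X , F∩A≗A-a)
    with split-off-one {p = F} {q = A} size-F
    where
    size-F : size F ≡ suc (size (F ∩ A))
    size-F = begin
      size F                ≡⟨ trans sizeF≡d (sym size≡d) ⟩
      size A                ≡⟨ sumOver-remove {p = A} (λ _ → 1) Aa ⟩
      suc (size (A - a))    ≡⟨ cong suc (sumOver-cong (λ _ → 1) F∩A≗A-a) ⟨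
      suc (size (F ∩ A))    ∎
      where open ≡-Reasoning
  ... | b , F∖A≗b = b , Ab , trans (cong X total≡) total∈X
    where
    F∖A-at-b : F b ∧ not (A b) ≡ true
    F∖A-at-b = trans (F∖A≗b b) (x∈⁅x⁆ b)
    Ab : A b ≡ false
    Ab = not-injective (∧-conicalʳ (F b) _ F∖A-at-b)
    F≗ : F ≗ insert b (A - a)
    F≗ i = trans (insert-split {p = F} {q = A} F∖A≗b i) (cong (⁅ b ⁆ i ∨_) (F∩A≗A-a i))
    total≡ : shift (translationOffset A a) b ≡ elemTotal F mod n
    total≡ = trans (sym (coSingleton-total {A} Aa Ab)) (cong (_mod n) (sumOver-cong toℕ (sym ∘ F≗)))

  elemTotal-translate : ∀ {X A} t → size A ≡ d → X ∘ shift t ≗ A → elemTotal X ≈ t * d + elemTotal A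
  elemTotal-translate {X} {A} t size≡d image = begin
    elemTotal X                        ≡⟨ sumOver-image (shiftPerm t) {p = X} toℕ image ⟩
    sumOver A (toℕ ∘ shift t)          ≈⟨ sumOver-cong-≈ A (λ j → toℕ-mod (t + toℕ j)) ⟩
    sumOver A (λ j → t + toℕ j)        ≡⟨ sumOver-+ A (λ _ → t) toℕ ⟩
    sumOver A (λ _ → t) + elemTotal A  ≡⟨ cong (_+ elemTotal A) (sumOver-const A t) ⟩
    t * size A + elemTotal A           ≡⟨ cong (λ s → t * s + elemTotal A) size≡d ⟩
    t * d + elemTotal A                ∎
    where open ≈-Reasoning

  elemTotal-reflect : ∀ {X A} c → size A ≡ d → X ∘ reflect c ≗ A → elemTotal X + elemTotal A ≈ c * d
  elemTotal-reflect {X} {A} c size≡d image = begin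
    elemTotal X + elemTotal A                   ≡⟨ cong (_+ elemTotal A) pullback ⟩
    sumOver A (toℕ ∘ reflect c) + elemTotal A   ≈⟨ +-congʳ (elemTotal A) (sumOver-cong-≈ A reduce) ⟩
    sumOver A (λ j → c + negate (toℕ j)) + S    ≡⟨ cong (_+ S) (sumOver-+ A (λ _ → c) (negate ∘ toℕ)) ⟩
    C + sumOver A (negate ∘ toℕ) + S            ≡⟨ +-assoc C (sumOver A (negate ∘ toℕ)) S ⟩
    C + (sumOver A (negate ∘ toℕ) + S)          ≡⟨ cong (C +_) (sumOver-+ A (negate ∘ toℕ) toℕ) ⟨
    C + sumOver A (λ j → negate (toℕ j) + toℕ j) ≈⟨ +-congˡ C (sumOver-cong-≈ A (+-inverseˡ ∘ toℕ)) ⟩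
    C + sumOver A (λ _ → 0)                     ≡⟨ cong (C +_) (sumOver-const A 0) ⟩
    C + 0                                       ≡⟨ +-identityʳ C ⟩
    C                                           ≡⟨ sumOver-const A c ⟩
    c * size A                                  ≡⟨ cong (c *_) size≡d ⟩
    c * d                                       ∎
    where
    open ≈-Reasoning
    S = elemTotal A
    C = sumOver A (λ _ → c)
    pullback : elemTotal X ≡ sumOver A (toℕ ∘ reflect c)
    pullback = sumOver-image (reflectPerm c) {p = X} toℕ image
    reduce : ∀ j → toℕ (reflect c j) ≈ c + negate (toℕ j)
    reduce j = toℕ-mod (c + negate (toℕ j))

  reflection⇒violation : ∀ {X A a} → size A ≡ d → A a ≡ true →
                         X ∘ reflect (reflectionCentre A a) ≗ A →
                         Violation X (reflect (reflectionCentre A a) a)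
  reflection⇒violation {X} {A} {a} size≡d Aa image = Xu , d∣r
    where
    c = reflectionCentre A a
    u = reflect c a
    r = elemTotal X ∸ toℕ u
    Xu : X u ≡ true
    Xu = trans (image a) Aa
    u≈ : toℕ u ≈ elemTotal (∁ A)
    u≈ = ≈-trans (toℕ-mod (c + negate (toℕ a))) (+-negate-cancel (elemTotal (∁ A)) (toℕ a))
    total+r≈cd : sum {n} toℕ + r ≈ c * d
    total+r≈cd = begin
      sum {n} toℕ + r                      ≡⟨ cong (_+ r) (sumOver-∁ A toℕ) ⟨
      elemTotal A + elemTotal (∁ A) + r    ≈⟨ +-congʳ r (+-congˡ (elemTotal A) (≈-sym u≈)) ⟩
      elemTotal A + toℕ u + r              ≡⟨ xy∙z≈zy∙x (elemTotal A) (toℕ u) r ⟩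
      r + toℕ u + elemTotal A              ≡⟨ cong (_+ elemTotal A) (m∸n+n≡m (toℕ≤elemTotal {p = X} Xu)) ⟩
      elemTotal X + elemTotal A            ≈⟨ elemTotal-reflect {X} c size≡d image ⟩
      c * d                                ∎
      where open ≈-Reasoning
    d∣r : d ∣ r
    d∣r = ∣m+n∣m⇒∣n (∣-respects-≈ d∣n (≈-sym total+r≈cd) (n∣m*n c)) d∣sum-toℕ

  translation⇒violation : ∀ {X A a} → size A ≡ d → A a ≡ true →
                          X ∘ shift (translationOffset A a) ≗ A →
                          Violation X (shift (translationOffset A a) a)
  translation⇒violation {X} {A} {a} size≡d Aa image = Xu , d∣r
    where
    e = translationOffset A a
    u = shift e a
    r = elemTotal X ∸ toℕ u
    Xu : X u ≡ true
    Xu = trans (image a) Aa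
    u≈ : toℕ u ≈ elemTotal A
    u≈ = ≈-trans (toℕ-mod (e + toℕ a)) (negate-+-cancel (elemTotal A) (toℕ a))
    r≈ed : r ≈ e * d
    r≈ed = +-cancelʳ (toℕ u) (begin
      r + toℕ u            ≡⟨ m∸n+n≡m (toℕ≤elemTotal {p = X} Xu) ⟩
      elemTotal X          ≈⟨ elemTotal-translate {X} e size≡d image ⟩
      e * d + elemTotal A  ≈⟨ +-congˡ (e * d) (≈-sym u≈) ⟩
      e * d + toℕ u        ∎)
      where open ≈-Reasoning
    d∣r : d ∣ r
    d∣r = ∣-respects-≈ d∣n (≈-sym r≈ed) (n∣m*n e)

  translate-offset : ∀ {X u} t → size X ≡ d → X u ≡ true → elemTotal X ∸ toℕ u ≡ t * d →
                     translationOffset (X ∘ shift t) (shift (negate t) u) ≈ t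
  translate-offset {X} {u} t size≡d Xu r≡td = +-cancelʳ (toℕ a) (begin
    elemTotal A + negate (toℕ a) + toℕ a  ≈⟨ negate-+-cancel (elemTotal A) (toℕ a) ⟩
    elemTotal A                           ≈⟨ ≈-sym u≈ ⟩
    toℕ u                                 ≈⟨ ≈-sym t+a≈u ⟩
    t + toℕ a                             ∎)
    where
    open ≈-Reasoning
    A = X ∘ shift t
    a = shift (negate t) u
    size-A : size A ≡ d
    size-A = trans (size-∘permutation (shiftPerm t) X) size≡d
    u≈ : toℕ u ≈ elemTotal A
    u≈ = +-cancelˡ (t * d) (begin
      t * d + toℕ u                ≡⟨ cong (_+ toℕ u) r≡td ⟨
      elemTotal X ∸ toℕ u + toℕ u  ≡⟨ m∸n+n≡m (toℕ≤elemTotal {p = X} Xu) ⟩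
      elemTotal X                  ≈⟨ elemTotal-translate {X} t size-A (λ _ → refl) ⟩
      t * d + elemTotal A          ∎)
    t+a≈u : t + toℕ a ≈ toℕ u
    t+a≈u = begin
      t + toℕ a                ≈⟨ +-congˡ t (toℕ-mod (negate t + toℕ u)) ⟩
      t + (negate t + toℕ u)   ≡⟨ +-assoc t (negate t) (toℕ u) ⟨
      t + negate t + toℕ u     ≈⟨ +-congʳ (toℕ u) (+-inverseʳ t) ⟩
      toℕ u                    ∎

  coSingletons⇒no-violation : ∀ {X} → size X ≡ d →
    (∀ A a → size A ≡ d → A a ≡ true → InProjection X A (A - a)) → ∀ u → ¬ Violation X u
  coSingletons⇒no-violation {X} size≡d full u (Xu , divides t r≡td) =
    no-hit (coSingleton-∈projection⁻ {X} {A} size-A Aa (full A a size-A Aa))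
    where
    A = X ∘ shift t
    a = shift (negate t) u
    size-A : size A ≡ d
    size-A = trans (size-∘permutation (shiftPerm t) X) size≡d
    Aa : A a ≡ true
    Aa = trans (cong X (shift-cancel {t} (+-inverseʳ t) u)) Xu
    no-hit : ¬ ∃ λ b → A b ≡ false × X (shift (translationOffset A a) b) ≡ true
    no-hit (b , Ab , hit) = contradiction (trans (sym Ab) X-shift-b) λ ()
      where
      X-shift-b : X (shift t b) ≡ true
      X-shift-b = trans (cong X (sym (shift-cong (translate-offset {X} t size≡d Xu r≡td) b))) hit

  no-violation⇒singleton : ∀ {X A a} → size X ≡ d → (∀ u → ¬ Violation X u) →
                           size A ≡ d → A a ≡ true → InProjection X A ⁅ a ⁆
  no-violation⇒singleton {X} {A} {a} size-X no-violation size-A Aa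
    with hit-or-image {p = X} {q = A} (reflectPerm (reflectionCentre A a)) (trans size-X (sym size-A))
  ... | inj₁ (b , Ab , hit) = singleton-∈projection⁺ {X} size-A Aa Ab hit
  ... | inj₂ image          = contradiction (reflection⇒violation {X} size-A Aa image) (no-violation _)

  no-violation⇒coSingleton : ∀ {X A a} → size X ≡ d → (∀ u → ¬ Violation X u) →
                             size A ≡ d → A a ≡ true → InProjection X A (A - a)
  no-violation⇒coSingleton {X} {A} {a} size-X no-violation size-A Aa
    with hit-or-image {p = X} {q = A} (shiftPerm (translationOffset A a)) (trans size-X (sym size-A))
  ... | inj₁ (b , Ab , hit) = coSingleton-∈projection⁺ {X} size-A Aa Ab hit
  ... | inj₂ image          = contradiction (translation⇒violation {X} size-A Aa image) (no-violation _)

∣∣≡size : ∀ {m} (S : Subset m) → ∣ S ∣ ≡ size (lookup S)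
∣∣≡size []          = refl
∣∣≡size (true ∷ S)  = cong suc (∣∣≡size S)
∣∣≡size (false ∷ S) = ∣∣≡size S

listSum-filter : ∀ {m k} (p : Fin m → Bool) (w : Fin m → ℕ) (g : Fin k → Fin m) →
                 listSum (List.map w (List.filterᵇ p (List.tabulate g))) ≡ sumOver (p ∘ g) (w ∘ g)
listSum-filter {k = zero}  p w g = refl
listSum-filter {k = suc k} p w g with p (g Fin.zero)
... | true  = cong (w (g Fin.zero) +_) (listSum-filter p w (g ∘ Fin.suc))
... | false = listSum-filter p w (g ∘ Fin.suc)

elemSum≡elemTotal : ∀ {m} (S : Subset m) → elemSum S ≡ elemTotal (lookup S)
elemSum≡elemTotal S = listSum-filter (lookup S) toℕ (λ i → i)

size-lookup : ∀ {m c} (S : Subset m) → ∣ S ∣ ≡ c → size (lookup S) ≡ c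
size-lookup S ∣S∣≡c = trans (sym (∣∣≡size S)) ∣S∣≡c

∣tabulate∣≡size : ∀ {m} (p : Fin m → Bool) → ∣ tabulate p ∣ ≡ size p
∣tabulate∣≡size p = trans (∣∣≡size (tabulate p)) (sumOver-cong (λ _ → 1) (lookup∘tabulate p))

lookup-⊆ : ∀ {m} {S T : Subset m} → S Sub.⊆ T → lookup S ⊆ lookup T
lookup-⊆ {S = S} {T} S⊆T i Si = []=⇒lookup (S⊆T (lookup⇒[]= i S Si))

tabulate-⊆ : ∀ {m} {p q : Fin m → Bool} → p ⊆ q → tabulate p Sub.⊆ tabulate q
tabulate-⊆ {p = p} {q} p⊆q {i} i∈p = lookup⇒[]= i (tabulate q) (trans (lookup∘tabulate q i) (p⊆q i pi))
  where
  pi : p i ≡ true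
  pi = trans (sym (lookup∘tabulate p i)) ([]=⇒lookup i∈p)

lookup-≗⇒≡ : ∀ {m} {S T : Subset m} → lookup S ≗ lookup T → S ≡ T
lookup-≗⇒≡ {S = S} {T} S≗T =
  trans (sym (tabulate∘lookup S)) (trans (tabulate-cong S≗T) (tabulate∘lookup T))

module _ (k : ℕ) where

  private
    n = twoD k
    d = dOf k

  open Core (2 * k)

  inProj⇒InProjection : ∀ {X A B} → inProj k X A B → InProjection (lookup X) (lookup A) (lookup B)
  inProj⇒InProjection {X} {A} {B} (F , (∣F∣≡d , sum∈X) , F∩A≡B) =
    lookup F ,
    size-lookup F ∣F∣≡d ,
    subst (λ s → lookup X (s mod n) ≡ true) (elemSum≡elemTotal F) ([]=⇒lookup sum∈X) ,
    λ i → trans (sym (lookup-zipWith _∧_ i F A)) (cong (λ S → lookup S i) F∩A≡B)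

  InProjection⇒inProj : ∀ {X A B} → InProjection (lookup X) (lookup A) (lookup B) → inProj k X A B
  InProjection⇒inProj {X} {A} {B} (F , size≡d , total∈X , F∩A≗B) =
    tabulate F ,
    (trans (∣tabulate∣≡size F) size≡d ,
     lookup⇒[]= _ X (subst (λ s → lookup X (s mod n) ≡ true) (sym sum≡) total∈X)) ,
    lookup-≗⇒≡ trace
    where
    trace : ∀ i → lookup (tabulate F Sub.∩ A) i ≡ lookup B i
    trace i = trans (lookup-zipWith _∧_ i (tabulate F) A)
                    (trans (cong (_∧ lookup A i) (lookup∘tabulate F i)) (F∩A≗B i))
    sum≡ : elemSum (tabulate F) ≡ elemTotal F
    sum≡ = trans (elemSum≡elemTotal (tabulate F)) (sumOver-cong toℕ (lookup∘tabulate F))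

  sumCond⇒no-violation : ∀ X → sumCond k X → ∀ u → ¬ Violation (lookup X) u
  sumCond⇒no-violation X cond u (Xu , d∣r) = cond u (lookup⇒[]= u X Xu) r%d≡0
    where
    r%d≡0 : (elemSum X ∸ toℕ u) % d ≡ 0
    r%d≡0 = trans (cong (λ s → (s ∸ toℕ u) % d) (elemSum≡elemTotal X)) (n∣m⇒m%n≡0 _ d d∣r)

  no-violation⇒sumCond : ∀ X → (∀ u → ¬ Violation (lookup X) u) → sumCond k X
  no-violation⇒sumCond X no-violation u u∈X r%d≡0 = no-violation u ([]=⇒lookup u∈X , d∣r)
    where
    d∣r : d ∣ elemTotal (lookup X) ∸ toℕ u
    d∣r = subst (λ s → d ∣ s ∸ toℕ u) (elemSum≡elemTotal X) (m%n≡0⇒n∣m _ d r%d≡0)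

  full⇒coSingletons : ∀ X → (∀ A → ∣ A ∣ ≡ d → projFull k X A) →
                      ∀ A a → size A ≡ d → A a ≡ true → InProjection (lookup X) A (A - a)
  full⇒coSingletons X full A a size-A Aa =
    InProjection-cong {lookup X} (lookup∘tabulate A) (lookup∘tabulate (A - a))
      (inProj⇒InProjection (full (tabulate A) (trans (∣tabulate∣≡size A) size-A)
                                 (tabulate (A - a)) (tabulate-⊆ A-a⊆A) (inj₂ ∣A-a∣≡d-1)))
    where
    A-a⊆A : A - a ⊆ A
    A-a⊆A i = ∧-conicalˡ (A i) _
    ∣A-a∣≡d-1 : ∣ tabulate (A - a) ∣ ≡ d ∸ 1
    ∣A-a∣≡d-1 = trans (∣tabulate∣≡size (A - a))
                      (suc-injective (trans (sym (sumOver-remove {p = A} (λ _ → 1) Aa)) size-A))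

  no-violation⇒full : ∀ X → ∣ X ∣ ≡ d → (∀ u → ¬ Violation (lookup X) u) → ∀ A → ∣ A ∣ ≡ d → projFull k X A
  no-violation⇒full X ∣X∣≡d no-violation A ∣A∣≡d B B⊆A ∣B∣ = InProjection⇒inProj (trace ∣B∣)
    where
    size-X = size-lookup X ∣X∣≡d
    size-A = size-lookup A ∣A∣≡d
    trace : ∣ B ∣ ≡ 1 ⊎ ∣ B ∣ ≡ d ∸ 1 → InProjection (lookup X) (lookup A) (lookup B)
    trace (inj₁ ∣B∣≡1) with size≡1∧⊆⇒singleton (lookup-⊆ B⊆A) (size-lookup B ∣B∣≡1)
    ... | a , Aa , B≗a = InProjection-cong {lookup X} (λ _ → refl) (sym ∘ B≗a)
                           (no-violation⇒singleton size-X no-violation size-A Aa)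
    trace (inj₂ ∣B∣≡d-1)
      with size≡suc∧⊆⇒remove (lookup-⊆ B⊆A) (trans size-A (cong suc (sym (size-lookup B ∣B∣≡d-1))))
    ... | a , Aa , B≗A-a = InProjection-cong {lookup X} (λ _ → refl) (sym ∘ B≗A-a)
                             (no-violation⇒coSingleton size-X no-violation size-A Aa)

  allFull⇒sumCond : ∀ X → ∣ X ∣ ≡ d → (∀ A → ∣ A ∣ ≡ d → projFull k X A) → sumCond k X
  allFull⇒sumCond X ∣X∣≡d full =
    no-violation⇒sumCond X (coSingletons⇒no-violation (size-lookup X ∣X∣≡d) (full⇒coSingletons X full))

  sumCond⇒allFull : ∀ X → ∣ X ∣ ≡ d → sumCond k X → ∀ A → ∣ A ∣ ≡ d → projFull k X A
  sumCond⇒allFull X ∣X∣≡d cond = no-violation⇒full X ∣X∣≡d (sumCond⇒no-violation X cond)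

lemma4 : (k : ℕ) → 1 ≤ k → (X : Subset (twoD k)) → ∣ X ∣ ≡ dOf k →
    (((A : Subset (twoD k)) → ∣ A ∣ ≡ dOf k → projFull k X A) → sumCond k X)
    × (sumCond k X → ((A : Subset (twoD k)) → ∣ A ∣ ≡ dOf k → projFull k X A))
lemma4 k _ X ∣X∣≡d = allFull⇒sumCond k X ∣X∣≡d , sumCond⇒allFull k X ∣X∣≡d
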